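{- Let $G(t)\in\mathbb{Z}[t]$ with $\deg(G)=N$, and suppose that $G(t)$ factors into a product of distinct non-constant polynomials that are irreducible over $\mathbb{Z}$, each of degree at most 3. If $G(t)$ has a local obstruction at the prime $\ell$ (i.e., $G(z)\equiv 0\pmod{\ell^2}$ for all $z\in(\mathbb{Z}/\ell^2\mathbb{Z})^*$), then $\ell\le (N_\ell+2)/2$, where $N_\ell$ is the number of not-necessarily distinct non-constant linear factors of $G(t)$ in $\mathbb{F}_\ell[t]$. -}

module Defs where

open import Data.Nat as ℕ using (ℕ; zero; suc)
open import Data.Integer as ℤ using (ℤ; +_; -_)
open import Data.Integer.Divisibility as ℤD using ()
open import Data.List using (List; []; _∷_; foldr; map; allFin)
open import Data.List.Relation.Unary.All using (All)
open import Data.List.Relation.Unary.AllPairs using (AllPairs)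
open import Data.Fin using (Fin; toℕ)
open import Data.Product using (Σ; _×_; ∃; ∃-syntax)
open import Data.Sum using (_⊎_)
open import Relation.Binary.PropositionalEquality using (_≡_; _≢_)
open import Relation.Nullary using (¬_)
open import Data.Nat.Divisibility using () renaming (_∣_ to _∣ℕ_)
open import Data.Nat.ListAction using (sum)

-- Polynomials in ℤ[t] as coefficient lists, lowest degree first.
-- Trailing zeros are allowed; polynomials are compared coefficientwise.
Poly : Set
Poly = List ℤ

coeff : Poly → ℕ → ℤ
coeff []       _       = + 0
coeff (a ∷ p)  zero    = a
coeff (a ∷ p)  (suc n) = coeff p n

infix 4 _≈ₚ_
_≈ₚ_ : Poly → Poly → Set
p ≈ₚ q = ∀ n → coeff p n ≡ coeff q n

_+ₚ_ : Poly → Poly → Poly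
[]      +ₚ q       = q
(a ∷ p) +ₚ []      = a ∷ p
(a ∷ p) +ₚ (b ∷ q) = (a ℤ.+ b) ∷ (p +ₚ q)

scale : ℤ → Poly → Poly
scale c = map (c ℤ.*_)

negₚ : Poly → Poly
negₚ = map (-_)

_*ₚ_ : Poly → Poly → Poly
[]      *ₚ q = []
(a ∷ p) *ₚ q = scale a q +ₚ (+ 0 ∷ (p *ₚ q))

oneₚ : Poly
oneₚ = + 1 ∷ []

_^ₚ_ : Poly → ℕ → Poly
p ^ₚ zero  = oneₚ
p ^ₚ suc m = p *ₚ (p ^ₚ m)

productₚ : List Poly → Poly
productₚ = foldr _*ₚ_ oneₚ

eval : Poly → ℤ → ℤ
eval []      z = + 0
eval (a ∷ p) z = a ℤ.+ z ℤ.* eval p z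

linear : ℤ → Poly
linear a = (- a) ∷ + 1 ∷ []

-- degree (as a relation, since trailing zeros are allowed)
HasDegree : Poly → ℕ → Set
HasDegree p d = coeff p d ≢ + 0 × (∀ n → d ℕ.< n → coeff p n ≡ + 0)

NonConstantDeg≤3 : Poly → Set
NonConstantDeg≤3 p = ∃[ d ] (HasDegree p d × 1 ℕ.≤ d × d ℕ.≤ 3)

-- units of ℤ[t] are ±1
IsUnitₚ : Poly → Set
IsUnitₚ p = p ≈ₚ oneₚ ⊎ p ≈ₚ negₚ oneₚ

IsZeroₚ : Poly → Set
IsZeroₚ p = p ≈ₚ []

Irreducibleℤ : Poly → Set
Irreducibleℤ p = ¬ IsZeroₚ p × ¬ IsUnitₚ p
               × (∀ a b → p ≈ₚ a *ₚ b → IsUnitₚ a ⊎ IsUnitₚ b)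

Associated : Poly → Poly → Set
Associated p q = p ≈ₚ q ⊎ p ≈ₚ negₚ q

-- reduction mod ℓ: congruence of polynomials in 𝔽_ℓ[t]
CongMod : ℕ → Poly → Poly → Set
CongMod ℓ p q = ∀ n → (+ ℓ) ℤD.∣ (coeff p n ℤ.- coeff q n)

DividesMod : ℕ → Poly → Poly → Set
DividesMod ℓ d g = ∃[ h ] CongMod ℓ g (d *ₚ h)

LinearMultiplicity : ℕ → Poly → ℤ → ℕ → Set
LinearMultiplicity ℓ g a m =
  DividesMod ℓ (linear a ^ₚ m) g × ¬ DividesMod ℓ (linear a ^ₚ suc m) g

LocalObstruction : Poly → ℕ → Set
LocalObstruction G ℓ =
  ∀ (z : ℕ) → z ℕ.< ℓ ℕ.* ℓ → ¬ (ℓ ∣ℕ z) → (+ (ℓ ℕ.* ℓ)) ℤD.∣ eval G (+ z)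

-- N_ℓ given root multiplicities m : 𝔽_ℓ → ℕ
sumFin : (ℓ : ℕ) → (Fin ℓ → ℕ) → ℕ
sumFin ℓ m = sum (map m (allFin ℓ))

-- For a unit residue a mod ℓ, write G = G(a) + (t − a) Q with Q(a) = G′(a). Then
-- G(a + ℓ) ≡ G(a) + ℓ G′(a) (mod ℓ²), so a local obstruction forces ℓ ∣ G(a) and ℓ ∣ G′(a):
-- (t − a)² divides G in 𝔽_ℓ[t]. Each of the ℓ − 1 units is therefore a root of multiplicity
-- at least 2, whence N_ℓ ≥ 2(ℓ − 1).

module Submission where

open import Defs

module ℤ[t] where

  open import Data.Nat using (zero; suc; _≤_; s≤s)
  open import Data.Nat.Properties using (≮⇒≥)
  open import Data.Integer using (ℤ; +_; -_; _+_; _-_; _*_; NonZero)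
  open import Data.Integer.Properties using (i≡j⇒i-j≡0; +-identityˡ; +-identityʳ; *-identityˡ; *-zeroˡ; *-zeroʳ; *-distribʳ-+; *-assoc)
  open import Data.Integer.Tactic.RingSolver using (solve-∀)
  open import Data.Integer.Divisibility.Signed using (_∣_; divides; ∣ᵤ⇒∣; ∣⇒∣ᵤ; ∣m∣n⇒∣m+n; ∣m∣n⇒∣m-n; ∣n⇒∣m*n; ∣m⇒∣m*n; ∣-refl; ∣-trans; *-cancelˡ-∣)
  open import Data.Product using (_,_)
  open import Data.List using ([]; _∷_)
  open import Relation.Binary.PropositionalEquality

  coeff-+ₚ : ∀ p q n → coeff (p +ₚ q) n ≡ coeff p n + coeff q n
  coeff-+ₚ []      q       n       = sym (+-identityˡ (coeff q n))
  coeff-+ₚ (a ∷ p) []      n       = sym (+-identityʳ (coeff (a ∷ p) n))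
  coeff-+ₚ (a ∷ p) (b ∷ q) zero    = refl
  coeff-+ₚ (a ∷ p) (b ∷ q) (suc n) = coeff-+ₚ p q n

  coeff-scale : ∀ c p n → coeff (scale c p) n ≡ c * coeff p n
  coeff-scale c []      n       = sym (*-zeroʳ c)
  coeff-scale c (a ∷ p) zero    = refl
  coeff-scale c (a ∷ p) (suc n) = coeff-scale c p n

  coeff-∷-*ₚ-zero : ∀ c p q → coeff ((c ∷ p) *ₚ q) zero ≡ c * coeff q zero
  coeff-∷-*ₚ-zero c p q = begin
    coeff (scale c q +ₚ (+ 0 ∷ p *ₚ q)) zero  ≡⟨ coeff-+ₚ (scale c q) _ zero ⟩
    coeff (scale c q) zero + + 0             ≡⟨ +-identityʳ _ ⟩
    coeff (scale c q) zero                   ≡⟨ coeff-scale c q zero ⟩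
    c * coeff q zero                         ∎
    where open ≡-Reasoning

  coeff-∷-*ₚ-suc : ∀ c p q n → coeff ((c ∷ p) *ₚ q) (suc n) ≡ c * coeff q (suc n) + coeff (p *ₚ q) n
  coeff-∷-*ₚ-suc c p q n = begin
    coeff (scale c q +ₚ (+ 0 ∷ p *ₚ q)) (suc n)  ≡⟨ coeff-+ₚ (scale c q) _ (suc n) ⟩
    coeff (scale c q) (suc n) + coeff (p *ₚ q) n ≡⟨ cong (_+ coeff (p *ₚ q) n) (coeff-scale c q (suc n)) ⟩
    c * coeff q (suc n) + coeff (p *ₚ q) n       ∎
    where open ≡-Reasoning

  *ₚ-identityˡ : ∀ p → oneₚ *ₚ p ≈ₚ p
  *ₚ-identityˡ p zero    = trans (coeff-∷-*ₚ-zero (+ 1) [] p) (*-identityˡ (coeff p zero))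
  *ₚ-identityˡ p (suc n) = begin
    coeff (oneₚ *ₚ p) (suc n)      ≡⟨ coeff-∷-*ₚ-suc (+ 1) [] p n ⟩
    + 1 * coeff p (suc n) + + 0    ≡⟨ +-identityʳ _ ⟩
    + 1 * coeff p (suc n)          ≡⟨ *-identityˡ _ ⟩
    coeff p (suc n)                ∎
    where open ≡-Reasoning

  *ₚ-distribʳ-+ₚ : ∀ p p′ q → (p +ₚ p′) *ₚ q ≈ₚ (p *ₚ q) +ₚ (p′ *ₚ q)
  *ₚ-distribʳ-+ₚ []      p′       q n = refl
  *ₚ-distribʳ-+ₚ (a ∷ p) []       q n = sym (trans (coeff-+ₚ ((a ∷ p) *ₚ q) [] n) (+-identityʳ _))
  *ₚ-distribʳ-+ₚ (a ∷ p) (b ∷ p′) q zero = begin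
    coeff (((a + b) ∷ (p +ₚ p′)) *ₚ q) zero                   ≡⟨ coeff-∷-*ₚ-zero (a + b) (p +ₚ p′) q ⟩
    (a + b) * coeff q zero                                    ≡⟨ *-distribʳ-+ (coeff q zero) a b ⟩
    a * coeff q zero + b * coeff q zero                       ≡⟨ cong₂ _+_ (coeff-∷-*ₚ-zero a p q) (coeff-∷-*ₚ-zero b p′ q) ⟨
    coeff ((a ∷ p) *ₚ q) zero + coeff ((b ∷ p′) *ₚ q) zero    ≡⟨ coeff-+ₚ ((a ∷ p) *ₚ q) _ zero ⟨
    coeff (((a ∷ p) *ₚ q) +ₚ ((b ∷ p′) *ₚ q)) zero            ∎
    where open ≡-Reasoning
  *ₚ-distribʳ-+ₚ (a ∷ p) (b ∷ p′) q (suc n) = begin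
    coeff (((a + b) ∷ (p +ₚ p′)) *ₚ q) (suc n)
      ≡⟨ coeff-∷-*ₚ-suc (a + b) (p +ₚ p′) q n ⟩
    (a + b) * coeff q (suc n) + coeff ((p +ₚ p′) *ₚ q) n
      ≡⟨ cong (_+_ ((a + b) * coeff q (suc n))) (trans (*ₚ-distribʳ-+ₚ p p′ q n) (coeff-+ₚ (p *ₚ q) _ n)) ⟩
    (a + b) * coeff q (suc n) + (coeff (p *ₚ q) n + coeff (p′ *ₚ q) n)
      ≡⟨ regroup a b (coeff q (suc n)) _ _ ⟩
    (a * coeff q (suc n) + coeff (p *ₚ q) n) + (b * coeff q (suc n) + coeff (p′ *ₚ q) n)
      ≡⟨ cong₂ _+_ (coeff-∷-*ₚ-suc a p q n) (coeff-∷-*ₚ-suc b p′ q n) ⟨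
    coeff ((a ∷ p) *ₚ q) (suc n) + coeff ((b ∷ p′) *ₚ q) (suc n)
      ≡⟨ coeff-+ₚ ((a ∷ p) *ₚ q) _ (suc n) ⟨
    coeff (((a ∷ p) *ₚ q) +ₚ ((b ∷ p′) *ₚ q)) (suc n)
      ∎
    where
    open ≡-Reasoning
    regroup : ∀ a b x u v → (a + b) * x + (u + v) ≡ (a * x + u) + (b * x + v)
    regroup = solve-∀

  scale-*ₚ : ∀ c p q → scale c p *ₚ q ≈ₚ scale c (p *ₚ q)
  scale-*ₚ c []      q n = refl
  scale-*ₚ c (a ∷ p) q zero = begin
    coeff ((c * a ∷ scale c p) *ₚ q) zero  ≡⟨ coeff-∷-*ₚ-zero (c * a) (scale c p) q ⟩
    c * a * coeff q zero                   ≡⟨ *-assoc c a _ ⟩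
    c * (a * coeff q zero)                 ≡⟨ cong (c *_) (coeff-∷-*ₚ-zero a p q) ⟨
    c * coeff ((a ∷ p) *ₚ q) zero          ≡⟨ coeff-scale c ((a ∷ p) *ₚ q) zero ⟨
    coeff (scale c ((a ∷ p) *ₚ q)) zero    ∎
    where open ≡-Reasoning
  scale-*ₚ c (a ∷ p) q (suc n) = begin
    coeff ((c * a ∷ scale c p) *ₚ q) (suc n)
      ≡⟨ coeff-∷-*ₚ-suc (c * a) (scale c p) q n ⟩
    c * a * coeff q (suc n) + coeff (scale c p *ₚ q) n
      ≡⟨ cong (_+_ (c * a * coeff q (suc n))) (trans (scale-*ₚ c p q n) (coeff-scale c (p *ₚ q) n)) ⟩
    c * a * coeff q (suc n) + c * coeff (p *ₚ q) n
      ≡⟨ factor c a _ _ ⟩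
    c * (a * coeff q (suc n) + coeff (p *ₚ q) n)
      ≡⟨ cong (c *_) (coeff-∷-*ₚ-suc a p q n) ⟨
    c * coeff ((a ∷ p) *ₚ q) (suc n)
      ≡⟨ coeff-scale c ((a ∷ p) *ₚ q) (suc n) ⟨
    coeff (scale c ((a ∷ p) *ₚ q)) (suc n)
      ∎
    where
    open ≡-Reasoning
    factor : ∀ c a x u → c * a * x + c * u ≡ c * (a * x + u)
    factor = solve-∀

  *ₚ-assoc : ∀ p r q → (p *ₚ r) *ₚ q ≈ₚ p *ₚ (r *ₚ q)
  *ₚ-assoc []      r q n = refl
  *ₚ-assoc (c ∷ p) r q n = begin
    coeff ((scale c r +ₚ (+ 0 ∷ p *ₚ r)) *ₚ q) n
      ≡⟨ trans (*ₚ-distribʳ-+ₚ (scale c r) _ q n) (coeff-+ₚ (scale c r *ₚ q) _ n) ⟩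
    coeff (scale c r *ₚ q) n + coeff ((+ 0 ∷ p *ₚ r) *ₚ q) n
      ≡⟨ cong₂ _+_ (scale-*ₚ c r q n) (shifted n) ⟩
    coeff (scale c (r *ₚ q)) n + coeff (+ 0 ∷ p *ₚ (r *ₚ q)) n
      ≡⟨ coeff-+ₚ (scale c (r *ₚ q)) _ n ⟨
    coeff (scale c (r *ₚ q) +ₚ (+ 0 ∷ p *ₚ (r *ₚ q))) n
      ∎
    where
    open ≡-Reasoning
    shifted : (+ 0 ∷ p *ₚ r) *ₚ q ≈ₚ + 0 ∷ p *ₚ (r *ₚ q)
    shifted zero    = trans (coeff-∷-*ₚ-zero (+ 0) (p *ₚ r) q) (*-zeroˡ (coeff q zero))
    shifted (suc n) = begin
      coeff ((+ 0 ∷ p *ₚ r) *ₚ q) (suc n)              ≡⟨ coeff-∷-*ₚ-suc (+ 0) (p *ₚ r) q n ⟩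
      + 0 * coeff q (suc n) + coeff ((p *ₚ r) *ₚ q) n  ≡⟨ cong (_+ coeff ((p *ₚ r) *ₚ q) n) (*-zeroˡ (coeff q (suc n))) ⟩
      + 0 + coeff ((p *ₚ r) *ₚ q) n                    ≡⟨ +-identityˡ _ ⟩
      coeff ((p *ₚ r) *ₚ q) n                          ≡⟨ *ₚ-assoc p r q n ⟩
      coeff (p *ₚ (r *ₚ q)) n                          ∎

  _∣0 : ∀ k → k ∣ + 0
  k ∣0 = divides (+ 0) refl

  ∣-diff-trans : ∀ {k x y z} → k ∣ x - y → k ∣ y - z → k ∣ x - z
  ∣-diff-trans {k} {x} {y} {z} k∣x-y k∣y-z =
    subst (k ∣_) (telescope x y z) (∣m∣n⇒∣m+n k∣x-y k∣y-z)
    where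
    telescope : ∀ x y z → (x - y) + (y - z) ≡ x - z
    telescope = solve-∀

  ≈ₚ⇒congMod : ∀ k p q → p ≈ₚ q → CongMod k p q
  ≈ₚ⇒congMod k p q p≈q n = ∣⇒∣ᵤ {+ k} (subst (+ k ∣_) (sym (i≡j⇒i-j≡0 (p≈q n))) ((+ k) ∣0))

  congMod-*ₚ : ∀ k d p q → CongMod k p q → CongMod k (d *ₚ p) (d *ₚ q)
  congMod-*ₚ k []      p q p≡q n       = ∣⇒∣ᵤ {+ k} ((+ k) ∣0)
  congMod-*ₚ k (c ∷ d) p q p≡q zero    = ∣⇒∣ᵤ {+ k} (subst (+ k ∣_) eq (∣n⇒∣m*n c (∣ᵤ⇒∣ (p≡q zero))))
    where
    factor : ∀ c x y → c * (x - y) ≡ c * x - c * y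
    factor = solve-∀
    eq : c * (coeff p zero - coeff q zero) ≡ coeff ((c ∷ d) *ₚ p) zero - coeff ((c ∷ d) *ₚ q) zero
    eq = trans (factor c _ _) (sym (cong₂ _-_ (coeff-∷-*ₚ-zero c d p) (coeff-∷-*ₚ-zero c d q)))
  congMod-*ₚ k (c ∷ d) p q p≡q (suc n) =
    ∣⇒∣ᵤ {+ k} (subst (+ k ∣_) eq (∣m∣n⇒∣m+n (∣n⇒∣m*n c (∣ᵤ⇒∣ (p≡q (suc n)))) (∣ᵤ⇒∣ (congMod-*ₚ k d p q p≡q n))))
    where
    regroup : ∀ c x y u v → c * (x - y) + (u - v) ≡ (c * x + u) - (c * y + v)
    regroup = solve-∀
    eq : c * (coeff p (suc n) - coeff q (suc n)) + (coeff (d *ₚ p) n - coeff (d *ₚ q) n)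
       ≡ coeff ((c ∷ d) *ₚ p) (suc n) - coeff ((c ∷ d) *ₚ q) (suc n)
    eq = trans (regroup c _ _ _ _) (sym (cong₂ _-_ (coeff-∷-*ₚ-suc c d p n) (coeff-∷-*ₚ-suc c d q n)))

  congMod-trans : ∀ k p q r → CongMod k p q → CongMod k q r → CongMod k p r
  congMod-trans k p q r p≡q q≡r n =
    ∣⇒∣ᵤ {+ k} (∣-diff-trans {x = coeff p n} {coeff q n} {coeff r n} (∣ᵤ⇒∣ (p≡q n)) (∣ᵤ⇒∣ (q≡r n)))

  dividesMod-oneₚ : ∀ k p → DividesMod k oneₚ p
  dividesMod-oneₚ k p = p , ≈ₚ⇒congMod k p (oneₚ *ₚ p) (λ n → sym (*ₚ-identityˡ p n))

  dividesMod-*ₚ : ∀ k c d p q → CongMod k p (c *ₚ q) → DividesMod k d q → DividesMod k (c *ₚ d) p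
  dividesMod-*ₚ k c d p q p≡cq (h , q≡dh) = h , congMod-trans k p (c *ₚ q) ((c *ₚ d) *ₚ h) p≡cq cq≡cdh
    where
    cq≡cdh : CongMod k (c *ₚ q) ((c *ₚ d) *ₚ h)
    cq≡cdh = congMod-trans k (c *ₚ q) (c *ₚ (d *ₚ h)) ((c *ₚ d) *ₚ h)
      (congMod-*ₚ k c q (d *ₚ h) q≡dh)
      (≈ₚ⇒congMod k (c *ₚ (d *ₚ h)) ((c *ₚ d) *ₚ h) (λ n → sym (*ₚ-assoc c d h n)))

  -- Synthetic division: p = (t − a) · quotLinear a p + p(a).
  quotLinear : ℤ → Poly → Poly
  quotLinear a []      = []
  quotLinear a (c ∷ p) = eval p a ∷ quotLinear a p

  eval-quotLinear : ∀ a p z → eval p z ≡ (z - a) * eval (quotLinear a p) z + eval p a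
  eval-quotLinear a []      z = vanish z a
    where
    vanish : ∀ z a → + 0 ≡ (z - a) * + 0 + + 0
    vanish = solve-∀
  eval-quotLinear a (c ∷ p) z =
    trans (cong (λ e → c + z * e) (eval-quotLinear a p z)) (horner c z a (eval (quotLinear a p) z) (eval p a))
    where
    horner : ∀ c z a q r → c + z * ((z - a) * q + r) ≡ (z - a) * (r + z * q) + (c + a * r)
    horner = solve-∀

  coeff-zero-quotLinear : ∀ a p → coeff p zero ≡ eval p a - a * coeff (quotLinear a p) zero
  coeff-zero-quotLinear a []      = vanish a
    where
    vanish : ∀ a → + 0 ≡ + 0 - a * + 0
    vanish = solve-∀
  coeff-zero-quotLinear a (c ∷ p) = cancel c a (eval p a)
    where
    cancel : ∀ c a r → c ≡ (c + a * r) - a * r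
    cancel = solve-∀

  coeff-suc-quotLinear : ∀ a p n → coeff p (suc n) ≡ coeff (quotLinear a p) n - a * coeff (quotLinear a p) (suc n)
  coeff-suc-quotLinear a []      n       = vanish a
    where
    vanish : ∀ a → + 0 ≡ + 0 - a * + 0
    vanish = solve-∀
  coeff-suc-quotLinear a (c ∷ p) zero    = coeff-zero-quotLinear a p
  coeff-suc-quotLinear a (c ∷ p) (suc n) = coeff-suc-quotLinear a p n

  congMod-linear-quotLinear : ∀ k a p → + k ∣ eval p a → CongMod k p (linear a *ₚ quotLinear a p)
  congMod-linear-quotLinear k a p k∣r zero = ∣⇒∣ᵤ {+ k} (subst (+ k ∣_) (sym remainder) k∣r)
    where
    q = quotLinear a p
    cancel : ∀ r a q → (r - a * q) - (- a * q) ≡ r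
    cancel = solve-∀
    remainder : coeff p zero - coeff (linear a *ₚ q) zero ≡ eval p a
    remainder = trans (cong₂ _-_ (coeff-zero-quotLinear a p) (coeff-∷-*ₚ-zero (- a) (+ 1 ∷ []) q))
                      (cancel (eval p a) a (coeff q zero))
  congMod-linear-quotLinear k a p k∣r (suc n) = ∣⇒∣ᵤ {+ k} (subst (+ k ∣_) (sym exact) ((+ k) ∣0))
    where
    q = quotLinear a p
    cancel : ∀ a x y → (y - a * x) - (- a * x + y) ≡ + 0
    cancel = solve-∀
    exact : coeff p (suc n) - coeff (linear a *ₚ q) (suc n) ≡ + 0
    exact = trans (cong₂ _-_ (coeff-suc-quotLinear a p n)
                             (trans (coeff-∷-*ₚ-suc (- a) (+ 1 ∷ []) q n) (cong (_+_ (- a * coeff q (suc n))) (*ₚ-identityˡ q n))))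
                  (cancel a (coeff q (suc n)) (coeff q n))

  eval-shift-quotLinear : ∀ a k p → let q = quotLinear a p in
    eval p (a + k) ≡ eval p a + k * eval q a + k * k * eval (quotLinear a q) (a + k)
  eval-shift-quotLinear a k p = begin
    eval p (a + k)
      ≡⟨ eval-quotLinear a p (a + k) ⟩
    (a + k - a) * eval q (a + k) + eval p a
      ≡⟨ cong (λ e → (a + k - a) * e + eval p a) (eval-quotLinear a q (a + k)) ⟩
    (a + k - a) * ((a + k - a) * eval (quotLinear a q) (a + k) + eval q a) + eval p a
      ≡⟨ expand a k _ _ _ ⟩
    eval p a + k * eval q a + k * k * eval (quotLinear a q) (a + k)
      ∎
    where
    open ≡-Reasoning
    q = quotLinear a p
    expand : ∀ a k r s t → (a + k - a) * ((a + k - a) * t + s) + r ≡ r + k * s + k * k * t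
    expand = solve-∀

  -- quotLinear a p evaluated at a is p′(a).
  ∣eval-quotLinear : ∀ k a p .{{_ : NonZero k}} →
    k * k ∣ eval p a → k * k ∣ eval p (a + k) → k ∣ eval (quotLinear a p) a
  ∣eval-quotLinear k a p k²∣p[a] k²∣p[a+k] = *-cancelˡ-∣ k (subst (k * k ∣_) difference k²∣difference)
    where
    q = quotLinear a p
    t = eval (quotLinear a q) (a + k)
    k²∣difference : k * k ∣ (eval p (a + k) - eval p a) - k * k * t
    k²∣difference = ∣m∣n⇒∣m-n (∣m∣n⇒∣m-n k²∣p[a+k] k²∣p[a]) (∣m⇒∣m*n t ∣-refl)
    isolate : ∀ k r s u → (r + k * s + k * k * u - r) - k * k * u ≡ k * s
    isolate = solve-∀
    difference : (eval p (a + k) - eval p a) - k * k * t ≡ k * eval q a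
    difference = trans (cong (λ e → (e - eval p a) - k * k * t) (eval-shift-quotLinear a k p))
                       (isolate k (eval p a) (eval q a) t)

  dividesMod-linear-^ₚ : ∀ k a p .{{_ : NonZero (+ k)}} →
    + k * + k ∣ eval p a → + k * + k ∣ eval p (a + + k) → ∀ j → j ≤ 2 → DividesMod k (linear a ^ₚ j) p
  dividesMod-linear-^ₚ k a p k²∣p[a] k²∣p[a+k] = divides-^ₚ
    where
    q = quotLinear a p
    p≡lq : CongMod k p (linear a *ₚ q)
    p≡lq = congMod-linear-quotLinear k a p (∣-trans (∣m⇒∣m*n (+ k) ∣-refl) k²∣p[a])
    q≡lq₂ : CongMod k q (linear a *ₚ quotLinear a q)
    q≡lq₂ = congMod-linear-quotLinear k a q (∣eval-quotLinear (+ k) a p k²∣p[a] k²∣p[a+k])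
    divides-^ₚ : ∀ j → j ≤ 2 → DividesMod k (linear a ^ₚ j) p
    divides-^ₚ zero             _ = dividesMod-oneₚ k p
    divides-^ₚ (suc zero)       _ = dividesMod-*ₚ k (linear a) oneₚ p q p≡lq (dividesMod-oneₚ k q)
    divides-^ₚ (suc (suc zero)) _ = dividesMod-*ₚ k (linear a) (linear a ^ₚ 1) p q p≡lq
      (dividesMod-*ₚ k (linear a) oneₚ q (quotLinear a q) q≡lq₂ (dividesMod-oneₚ k (quotLinear a q)))
    divides-^ₚ (suc (suc (suc j))) (s≤s (s≤s ()))

  multiplicity-≥ : ∀ {k m n} p a → LinearMultiplicity k p a m →
    (∀ j → j ≤ n → DividesMod k (linear a ^ₚ j) p) → n ≤ m
  multiplicity-≥ {m = m} p a (_ , ¬divides) powers-divide = ≮⇒≥ (λ m<n → ¬divides (powers-divide (suc m) m<n))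

open ℤ[t] using (dividesMod-linear-^ₚ; multiplicity-≥)

open import Data.Nat using (ℕ; zero; suc; _*_; _+_; _≤_; _<_; z≤n; z<s; >-nonZero; nonTrivial⇒n>1)
open import Data.Nat.Properties
  using (<-trans; <-≤-trans; m≤m*n; m≤n+m; +-comm; +-identityʳ; *-comm; *-suc; *-zeroʳ; +-mono-≤; +-monoʳ-≤; +-monoˡ-<; *-monoˡ-≤; module ≤-Reasoning)
open import Data.Nat.Divisibility using (_∣_; >⇒∤; ∣m+n∣m⇒∣n; ∣-refl)
open import Data.Nat.ListAction using (sum)
open import Data.Nat.Primality using (Prime; prime⇒nonTrivial)
open import Data.Integer as ℤ using (+_)
open import Data.Integer.Properties using (pos-*)
open import Data.Integer.Divisibility.Signed using (∣ᵤ⇒∣) renaming (_∣_ to _∣ℤ_)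
open import Data.Fin using (Fin; zero; suc; toℕ)
open import Data.Fin.Properties using (toℕ<n)
open import Data.List using (List)
open import Data.List.Properties using (map-tabulate)
open import Data.List.Relation.Unary.All using (All)
open import Data.List.Relation.Unary.AllPairs using (AllPairs)
open import Data.Product using (_×_)
open import Function using (id; _∘_)
open import Relation.Nullary using (¬_)
open import Relation.Binary.PropositionalEquality

localObstruction⇒dividesMod-linear-^ₚ : ∀ {ℓ i} G → 1 < ℓ → LocalObstruction G ℓ → 0 < i → i < ℓ →
  ∀ j → j ≤ 2 → DividesMod ℓ (linear (+ i) ^ₚ j) G
localObstruction⇒dividesMod-linear-^ₚ {ℓ} {i} G 1<ℓ obstruction 0<i i<ℓ =
  dividesMod-linear-^ₚ ℓ (+ i) G (square∣ i i<ℓ² ℓ∤i) (square∣ (i + ℓ) i+ℓ<ℓ² ℓ∤i+ℓ)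
  where
  instance
    ℓ≢0 = >-nonZero (<-trans z<s 1<ℓ)
  square∣ : ∀ z → z < ℓ * ℓ → ¬ ℓ ∣ z → + ℓ ℤ.* + ℓ ∣ℤ eval G (+ z)
  square∣ z z<ℓ² ℓ∤z = subst (_∣ℤ eval G (+ z)) (pos-* ℓ ℓ) (∣ᵤ⇒∣ (obstruction z z<ℓ² ℓ∤z))
  i<ℓ² : i < ℓ * ℓ
  i<ℓ² = <-≤-trans i<ℓ (m≤m*n ℓ ℓ)
  i+ℓ<ℓ² : i + ℓ < ℓ * ℓ
  i+ℓ<ℓ² = begin-strict
    i + ℓ      <⟨ +-monoˡ-< ℓ i<ℓ ⟩
    ℓ + ℓ      ≡⟨ cong (_+_ ℓ) (+-identityʳ ℓ) ⟨
    2 * ℓ      ≤⟨ *-monoˡ-≤ ℓ 1<ℓ ⟩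
    ℓ * ℓ      ∎
    where open ≤-Reasoning
  ℓ∤i : ¬ ℓ ∣ i
  ℓ∤i = >⇒∤ {{>-nonZero 0<i}} i<ℓ
  ℓ∤i+ℓ : ¬ ℓ ∣ i + ℓ
  ℓ∤i+ℓ ℓ∣i+ℓ = ℓ∤i (∣m+n∣m⇒∣n (subst (ℓ ∣_) (+-comm i ℓ) ℓ∣i+ℓ) ∣-refl)

sumFin-suc : ∀ n (m : Fin (suc n) → ℕ) → sumFin (suc n) m ≡ m zero + sumFin n (m ∘ suc)
sumFin-suc n m = cong (λ xs → m zero + sum xs) (trans (map-tabulate suc m) (sym (map-tabulate id (m ∘ suc))))

sumFin-≥ : ∀ {c} n (m : Fin n → ℕ) → (∀ j → c ≤ m j) → n * c ≤ sumFin n m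
sumFin-≥ zero    m c≤m = z≤n
sumFin-≥ {c} (suc n) m c≤m = begin
  suc n * c                          ≤⟨ +-mono-≤ (c≤m zero) (sumFin-≥ n (m ∘ suc) (c≤m ∘ suc)) ⟩
  m zero + sumFin n (m ∘ suc)        ≡⟨ sumFin-suc n m ⟨
  sumFin (suc n) m                   ∎
  where open ≤-Reasoning

sumFin-≥-except-zero : ∀ {c} n (m : Fin n → ℕ) → (∀ j → 0 < toℕ j → c ≤ m j) → c * n ≤ sumFin n m + c
sumFin-≥-except-zero {c} zero    m c≤m = subst (_≤ sumFin zero m + c) (sym (*-zeroʳ c)) z≤n
sumFin-≥-except-zero {c} (suc n) m c≤m = begin
  c * suc n                          ≡⟨ trans (*-suc c n) (cong (_+_ c) (*-comm c n)) ⟩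
  c + n * c                          ≤⟨ +-monoʳ-≤ c (sumFin-≥ n (m ∘ suc) (λ j → c≤m (suc j) z<s)) ⟩
  c + sumFin n (m ∘ suc)             ≤⟨ +-monoʳ-≤ c (m≤n+m _ (m zero)) ⟩
  c + (m zero + sumFin n (m ∘ suc))  ≡⟨ +-comm c _ ⟩
  (m zero + sumFin n (m ∘ suc)) + c  ≡⟨ cong (_+ c) (sumFin-suc n m) ⟨
  sumFin (suc n) m + c               ∎
  where open ≤-Reasoning

lemma2p15 : (G : Poly) (fs : List Poly)
    → G ≈ₚ productₚ fs
    → All (λ f → Irreducibleℤ f × NonConstantDeg≤3 f) fs
    → AllPairs (λ f g → ¬ Associated f g) fs
    → (ℓ : ℕ) → Prime ℓ
    → LocalObstruction G ℓ
    → (m : Fin ℓ → ℕ)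
    → (∀ a → LinearMultiplicity ℓ G (+ toℕ a) (m a))
    → 2 * ℓ ≤ sumFin ℓ m + 2
lemma2p15 G _ _ _ _ ℓ ℓ-prime obstruction m multiplicity =
  sumFin-≥-except-zero ℓ m λ a 0<a → multiplicity-≥ G (+ toℕ a) (multiplicity a)
    (localObstruction⇒dividesMod-linear-^ₚ G 1<ℓ obstruction 0<a (toℕ<n a))
  where
  1<ℓ : 1 < ℓ
  1<ℓ = nonTrivial⇒n>1 ℓ {{prime⇒nonTrivial ℓ-prime}}
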